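{- Let $M$ be a square $\{0,1\}$-matrix with exactly $k$ diagonal entries equal to $0$ and exactly $\ell$ diagonal entries equal to $1$, and let $D$ be a minimal $M$-obstruction. If $k\ge 2$ and $D$ contains a homogeneous strong clique $S$ with $|S|=k+1$, then $|V(D)|\le (k+1)(\ell+1)$. Similarly, if $\ell\ge 2$ and $D$ contains a homogeneous independent set $S$ with $|S|=\ell+1$, then $|V(D)|\le (k+1)(\ell+1)$.
   Context: Digraphs are finite, without loops and multiple arcs. A strong clique: set $C$ with both $(x,y),(y,x)$ arcs for all distinct $x,y\in C$; an independent set: set with no arcs between any two of its vertices. For disjoint $S,S'$, $S$ is completely adjacent (resp. completely non-adjacent) to $S'$ if $(x,x')$ is an arc for all (resp. no) $x\in S,x'\in S'$. An $M$-partition of $D$ ($M$ of size $k+\ell$) is a partition of $V(D)$ into possibly empty parts $V_1,\dots,V_{k+\ell}$ with $V_i$ independent if $M(i,i)=0$, a strong clique if $M(i,i)=1$, and for $i\ne j$, $V_i$ completely non-adjacent to $V_j$ if $M(i,j)=0$ and completely adjacent to $V_j$ if $M(i,j)=1$. A minimal $M$-obstruction is a digraph with no $M$-partition such that $D-v$ has an $M$-partition for every vertex $v$. For distinct vertices $u,v,w$, $w$ distinguishes $u,v$ if exactly one of $u,v$ is an in-neighbour of $w$ or exactly one is an out-neighbour of $w$; distinct $u,v$ are twins if no vertex distinguishes them. A homogeneous set is a set of vertices any two distinct members of which are twins in $D$; a homogeneous strong clique (resp. homogeneous independent set) is a homogeneous set that is a strong clique (resp. independent set). -}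

module Defs where

open import Data.Nat using (ℕ; zero; suc; _+_)
open import Data.Bool using (Bool; true; false)
open import Data.Fin using (Fin; zero; suc)
open import Data.Product using (_×_)
open import Data.Sum using (_⊎_)
open import Relation.Nullary using (¬_)
open import Relation.Binary.PropositionalEquality using (_≡_; _≢_)

record Digraph (n : ℕ) : Set where
  field
    arc   : Fin n → Fin n → Bool
    loopless : ∀ x → arc x x ≡ false
open Digraph public

Matrix : ℕ → Set
Matrix m = Fin m → Fin m → Bool

countFin : ∀ {m} → (Fin m → Bool) → Bool → ℕ
countFin {zero}  f b = 0
countFin {suc m} f true  with f zero
... | true  = suc (countFin (λ i → f (suc i)) true)
... | false = countFin (λ i → f (suc i)) true
countFin {suc m} f false with f zero
... | true  = countFin (λ i → f (suc i)) false
... | false = suc (countFin (λ i → f (suc i)) false)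

zerosOnDiag : ∀ {m} → Matrix m → ℕ
zerosOnDiag M = countFin (λ i → M i i) false

onesOnDiag : ∀ {m} → Matrix m → ℕ
onesOnDiag M = countFin (λ i → M i i) true

-- An M-partition of the subdigraph of D induced by {x | P x}: an assignment of
-- each such vertex to a (possibly empty) part in Fin m, such that for distinct x,y
-- (x,y) is an arc iff M(part x, part y) = 1.  For parts i = j this says V_i is
-- independent (M(i,i)=0) or a strong clique (M(i,i)=1); for i ≠ j it says V_i is
-- completely non-adjacent / completely adjacent to V_j.
HasMPartitionOn : ∀ {n m} → Matrix m → Digraph n → (Fin n → Set) → Set
HasMPartitionOn {n} {m} M D P =
  Σ' ((x : Fin n) → P x → Fin m) λ p →
    ∀ x y (px : P x) (py : P y) → x ≢ y → arc D x y ≡ M (p x px) (p y py)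
  where
  open import Data.Product using () renaming (Σ to Σ')

HasMPartition : ∀ {n m} → Matrix m → Digraph n → Set
HasMPartition M D = HasMPartitionOn M D (λ _ → ⊤')
  where open import Data.Unit using () renaming (⊤ to ⊤')

MinimalObstruction : ∀ {n m} → Matrix m → Digraph n → Set
MinimalObstruction M D =
  ¬ HasMPartition M D × (∀ v → HasMPartitionOn M D (λ x → x ≢ v))

Distinguishes : ∀ {n} → Digraph n → Fin n → Fin n → Fin n → Set
Distinguishes D w u v =
  w ≢ u × w ≢ v × (arc D u w ≢ arc D v w ⊎ arc D w u ≢ arc D w v)

Twins : ∀ {n} → Digraph n → Fin n → Fin n → Set
Twins D u v = u ≢ v × (∀ w → ¬ Distinguishes D w u v)

open import Data.Fin.Subset using (Subset; _∈_)

Homogeneous : ∀ {n} → Digraph n → Subset n → Set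
Homogeneous D S = ∀ u v → u ∈ S → v ∈ S → u ≢ v → Twins D u v

StrongClique : ∀ {n} → Digraph n → Subset n → Set
StrongClique D S = ∀ x y → x ∈ S → y ∈ S → x ≢ y → arc D x y ≡ true

Independent : ∀ {n} → Digraph n → Subset n → Set
Independent D S = ∀ x y → x ∈ S → y ∈ S → x ≢ y → arc D x y ≡ false

-- Let b be the arc value inside the homogeneous set (true: strong clique,
-- false: independent set) and K the number of diagonal entries of M equal to
-- ¬b.  The key fact (forced-parts) is that if T is a family of r+1 pairwise
-- twins with all arcs between them equal to b, then any M-partition of D - t,
-- t ∈ T, places the other r members in r distinct parts with diagonal ¬b:
-- otherwise t could join the part of one of them.  Hence r ≤ K (family-bound).
-- Now take v ∈ S and an M-partition P of D - v.  The K remaining vertices of S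
-- occupy all K parts with diagonal ¬b, so a further vertex z in such a part
-- would distinguish two of them; each ¬b-part therefore has one vertex.  The
-- vertices of a b-part form a twin family with arcs b, hence there are at most
-- K+1 of them.  Summing these capacities over the parts (weighted pigeonhole)
-- gives n ≤ 1 + (K+1)·L + K = (K+1)(L+1), L the number of b-parts.
module Submission where

open import Data.Bool using (Bool; true; false; not)
open import Data.Bool.Properties using (not-¬) renaming (_≟_ to _≟ᵇ_)
open import Data.Empty using (⊥; ⊥-elim)
open import Data.Fin using (Fin; zero; suc; punchIn)
open import Data.Fin.Properties
  using (suc-injective; punchIn-injective; punchInᵢ≢i; any?; 0≢1+n; _≟_)
open import Data.Fin.Subset using (Subset; ∣_∣; _∈_)
open import Data.Nat using (ℕ; zero; suc; pred; _*_; _+_; _≤_; z≤n; s≤s; >-nonZero)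
open import Data.Nat.Properties
  using ( +-suc; +-comm; *-comm; *-zeroʳ; suc-pred; pred-mono-≤; 1+n≰n; ≤-refl
        ; +-0-commutativeMonoid)
open import Algebra.Properties.CommutativeMonoid.Sum +-0-commutativeMonoid using (sum)
open import Data.Nat.Tactic.RingSolver using (solve-∀)
open import Data.Product using (Σ; ∃; _×_; _,_; proj₁; proj₂)
open import Data.Sum using (_⊎_; inj₁; inj₂)
open import Data.Vec using ([]; _∷_)
open import Data.Vec.Base using (here; there)
open import Data.Vec.Functional using (updateAt) renaming (_∷_ to _◂_)
open import Data.Vec.Functional.Properties using (updateAt-updates; updateAt-minimal)
open import Defs
open import Function using (_∘_; id)
open import Function.Definitions using (Injective)
open import Relation.Binary.Definitions using (DecidableEquality)
open import Relation.Binary.PropositionalEquality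
open import Relation.Nullary using (¬_; yes; no)
open import Relation.Nullary.Decidable using (decidable-stable)

Inj : ∀ {A B : Set} → (A → B) → Set
Inj = Injective _≡_ _≡_

record AtMost {A : Set} (Q : A → Set) (c : ℕ) : Set where
  field
    bounded : ∀ {s} (h : Fin s → A) → Inj h → (∀ a → Q (h a)) → s ≤ c
open AtMost public

cons-injective : ∀ {A : Set} {s} (x : A) (h : Fin s → A) →
                 Inj h → (∀ a → h a ≢ x) → Inj (x ◂ h)
cons-injective x h inj fresh {zero}  {zero}  _  = refl
cons-injective x h inj fresh {zero}  {suc b} eq = ⊥-elim (fresh b (sym eq))
cons-injective x h inj fresh {suc a} {zero}  eq = ⊥-elim (fresh a eq)
cons-injective x h inj fresh {suc a} {suc b} eq = cong suc (inj eq)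

atMost-pullback : ∀ {A B : Set} {Q : A → Set} {R : B → Set} {c} (g : B → A) →
                  Inj g → (∀ {y} → R y → Q (g y)) → AtMost Q c → AtMost R c
bounded (atMost-pullback g g-inj R⇒Q bound) h h-inj inR =
  bounded bound (g ∘ h) (λ eq → h-inj (g-inj eq)) (λ a → R⇒Q (inR a))

atMost-inhabited : ∀ {A : Set} {Q : A → Set} {c} {x} → AtMost Q c → Q x → 1 ≤ c
atMost-inhabited {x = x} bound qx =
  bounded bound (λ _ → x) (λ { {zero} {zero} _ → refl }) (λ _ → qx)

atMost-remove : ∀ {A : Set} {Q : A → Set} {c} {x} → AtMost Q c → Q x →
                AtMost (λ y → Q y × y ≢ x) (pred c)
bounded (atMost-remove {Q = Q} {x = x} bound qx) h h-inj inQ =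
  pred-mono-≤ (bounded bound (x ◂ h) (cons-injective x h h-inj (proj₂ ∘ inQ)) in-cons)
  where
  in-cons : ∀ a → Q ((x ◂ h) a)
  in-cons zero    = qx
  in-cons (suc a) = proj₁ (inQ a)

atMost-zero : ∀ {A : Set} {Q : A → Set} → (∀ x → ¬ Q x) → AtMost Q 0
bounded (atMost-zero empty) {zero}  h _ _  = z≤n
bounded (atMost-zero empty) {suc s} h _ inQ = ⊥-elim (empty (h zero) (inQ zero))

atMost-one : ∀ {A : Set} (x : A) → AtMost (_≡ x) 1
bounded (atMost-one x) {zero}        h _     _  = z≤n
bounded (atMost-one x) {suc zero}    h _     _  = ≤-refl
bounded (atMost-one x) {suc (suc s)} h h-inj eq =
  ⊥-elim (0≢1+n (h-inj (trans (eq zero) (sym (eq (suc zero))))))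

saturated-covers : ∀ {A : Set} {Q : A → Set} {r} → DecidableEquality A →
                   AtMost Q r → (g : Fin r → A) → Inj g → (∀ a → Q (g a)) →
                   ∀ {x} → Q x → ∃ λ a → g a ≡ x
saturated-covers {Q = Q} _≟A_ bound g g-inj inQ {x} qx
  with any? (λ a → g a ≟A x)
... | yes hit = hit
... | no miss = ⊥-elim (1+n≰n (bounded bound (x ◂ g) (cons-injective x g g-inj fresh) in-cons))
  where
  fresh : ∀ a → g a ≢ x
  fresh a eq = miss (a , eq)
  in-cons : ∀ a → Q ((x ◂ g) a)
  in-cons zero    = qx
  in-cons (suc a) = inQ a

sum-decrement : ∀ {m} (c : Fin m → ℕ) (i : Fin m) → 1 ≤ c i →
                sum c ≡ suc (sum (updateAt c i pred))
sum-decrement c zero    occupied =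
  cong (_+ sum (λ j → c (suc j))) (sym (suc-pred (c zero) {{>-nonZero occupied}}))
sum-decrement c (suc i) occupied =
  trans (cong (c zero +_) (sum-decrement (λ j → c (suc j)) i occupied)) (+-suc (c zero) _)

weighted-pigeonhole : ∀ {r m} (f : Fin r → Fin m) (c : Fin m → ℕ) →
                      (∀ i → AtMost (λ a → f a ≡ i) (c i)) → r ≤ sum c
weighted-pigeonhole {zero}  f c bound = z≤n
weighted-pigeonhole {suc r} f c bound =
  subst (suc r ≤_) (sym (sum-decrement c (f zero) occupied))
        (s≤s (weighted-pigeonhole (f ∘ suc) (updateAt c (f zero) pred) bound′))
  where
  occupied : 1 ≤ c (f zero)
  occupied = atMost-inhabited (bound (f zero)) refl
  bound′ : ∀ i → AtMost (λ a → f (suc a) ≡ i) (updateAt c (f zero) pred i)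
  bound′ i with i ≟ f zero
  ... | yes refl = subst (AtMost (λ a → f (suc a) ≡ i)) (sym (updateAt-updates (f zero) c))
          (atMost-pullback suc suc-injective (λ eq → eq , λ ())
             (atMost-remove (bound (f zero)) refl))
  ... | no i≢f0 = subst (AtMost (λ a → f (suc a) ≡ i)) (sym (updateAt-minimal i (f zero) c i≢f0))
          (atMost-pullback suc suc-injective id (bound i))

count-avoiding : ∀ {n m} (v : Fin n) (P : Fin n → Fin m) (c : Fin m → ℕ) →
                 (∀ i → AtMost (λ x → x ≢ v × P x ≡ i) (c i)) → n ≤ suc (sum c)
count-avoiding {zero}  ()
count-avoiding {suc n} v P c bound =
  s≤s (weighted-pigeonhole (P ∘ punchIn v) c λ i →
    atMost-pullback {R = λ a → P (punchIn v a) ≡ i} (punchIn v)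
                    (λ {a} {b} → punchIn-injective v a b) (λ eq → punchInᵢ≢i v _ , eq) (bound i))

bool-cases : ∀ β γ → γ ≡ β ⊎ γ ≡ not β
bool-cases true  true  = inj₁ refl
bool-cases true  false = inj₂ refl
bool-cases false true  = inj₂ refl
bool-cases false false = inj₁ refl

select : ℕ → ℕ → Bool → Bool → ℕ
select x y true  true  = x
select x y false false = x
select x y true  false = y
select x y false true  = y

select-match : ∀ {x y β γ} → γ ≡ β → select x y β γ ≡ x
select-match {β = true}  refl = refl
select-match {β = false} refl = refl

select-mismatch : ∀ {x y β γ} → γ ≡ not β → select x y β γ ≡ y
select-mismatch {β = true}  refl = refl
select-mismatch {β = false} refl = refl

sum-by-value : ∀ {m} (f : Fin m → Bool) (g : Bool → ℕ) →
               sum (g ∘ f) ≡ g true * countFin f true + g false * countFin f false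
sum-by-value {zero}  f g = sym (cong₂ _+_ (*-zeroʳ (g true)) (*-zeroʳ (g false)))
sum-by-value {suc m} f g with f zero | sum-by-value (f ∘ suc) g
... | true  | ih = trans (cong (g true +_) ih) (regroup (g true) (g false) _ _)
  where
  regroup : ∀ a b x y → a + (a * x + b * y) ≡ a * suc x + b * y
  regroup = solve-∀
... | false | ih = trans (cong (g false +_) ih) (regroup (g true) (g false) _ _)
  where
  regroup : ∀ a b x y → b + (a * x + b * y) ≡ a * x + b * suc y
  regroup = solve-∀

sum-select : ∀ {m} (f : Fin m → Bool) x y β →
             sum (λ i → select x y β (f i)) ≡ x * countFin f β + y * countFin f (not β)
sum-select f x y true  = sum-by-value f (select x y true)
sum-select f x y false =
  trans (sum-by-value f (select x y false)) (+-comm (y * countFin f true) (x * countFin f false))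

count-atMost : ∀ {m} (f : Fin m → Bool) (β : Bool) → AtMost (λ i → f i ≡ β) (countFin f β)
bounded (count-atMost f β) {s} h h-inj inβ =
  subst (s ≤_) (trans (sum-select f 1 0 β) (unit (countFin f β) (countFin f (not β))))
        (weighted-pigeonhole h (λ i → select 1 0 β (f i)) fibre)
  where
  unit : ∀ x y → 1 * x + 0 * y ≡ x
  unit = solve-∀
  fibre : ∀ i → AtMost (λ a → h a ≡ i) (select 1 0 β (f i))
  fibre i with bool-cases β (f i)
  ... | inj₁ match = subst (AtMost (λ a → h a ≡ i)) (sym (select-match match))
                       (atMost-pullback h h-inj id (atMost-one i))
  ... | inj₂ mismatch = subst (AtMost (λ a → h a ≡ i)) (sym (select-mismatch mismatch))
                          (atMost-zero λ a hit → not-¬ (trans (cong f (sym hit)) (inβ a)) mismatch)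

enumerate : ∀ {n} (S : Subset n) → Σ (Fin ∣ S ∣ → Fin n) λ e → Inj e × (∀ a → e a ∈ S)
enumerate [] = (λ ()) , (λ { {()} }) , (λ ())
enumerate (true ∷ S) with enumerate S
... | e , e-inj , e∈S =
  (zero ◂ suc ∘ e) , cons-injective zero (suc ∘ e) (e-inj ∘ suc-injective) (λ _ ()) , mem
  where
  mem : ∀ a → (zero ◂ suc ∘ e) a ∈ (true ∷ S)
  mem zero    = here
  mem (suc a) = there (e∈S a)
enumerate (false ∷ S) with enumerate S
... | e , e-inj , e∈S = suc ∘ e , e-inj ∘ suc-injective , there ∘ e∈S

another : ∀ {K} (a : Fin (suc (suc K))) → ∃ λ a′ → a′ ≢ a
another zero    = suc zero , λ ()
another (suc a) = zero , λ ()

module Obstruction {m n} (M : Matrix m) (D : Digraph n) where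

  diagonal : Fin m → Bool
  diagonal i = M i i

  Agree : Fin n → Fin n → Set
  Agree u v = ∀ w → w ≢ u → w ≢ v → arc D u w ≡ arc D v w × arc D w u ≡ arc D w v

  twins-agree : ∀ {u v} → Twins D u v → Agree u v
  twins-agree {u} {v} (_ , undistinguished) w w≢u w≢v =
    decidable-stable (arc D u w ≟ᵇ arc D v w) (λ ne → undistinguished w (w≢u , w≢v , inj₁ ne)) ,
    decidable-stable (arc D w u ≟ᵇ arc D w v) (λ ne → undistinguished w (w≢u , w≢v , inj₂ ne))

  Respects : Fin n → (Fin n → Fin m) → Set
  Respects v P = ∀ x y → x ≢ v → y ≢ v → x ≢ y → arc D x y ≡ M (P x) (P y)

  -- A partition of D - v as a total map, sending v to the part of some u ≠ v.
  partition-without : (∀ v → HasMPartitionOn M D (_≢ v)) → ∀ v {u} → u ≢ v →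
                      Σ (Fin n → Fin m) (Respects v)
  partition-without minimal v {u} u≢v = P , respects
    where
    p = proj₁ (minimal v)
    P : Fin n → Fin m
    P x with x ≟ v
    ... | yes _   = p u u≢v
    ... | no x≢v = p x x≢v
    respects : Respects v P
    respects x y x≢v y≢v x≢y with x ≟ v | y ≟ v
    ... | yes x≡v | _        = ⊥-elim (x≢v x≡v)
    ... | no _    | yes y≡v  = ⊥-elim (y≢v y≡v)
    ... | no x≢v′ | no y≢v′ = proj₂ (minimal v) x y x≢v′ y≢v′ x≢y

  extends : ∀ {v P} → Respects v P → (d : Fin m) →
            (∀ y → y ≢ v → arc D v y ≡ M d (P y) × arc D y v ≡ M (P y) d) →
            HasMPartition M D
  extends {v} {P} respects d fits = (λ x _ → R x) , λ x y _ _ → conforms x y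
    where
    R : Fin n → Fin m
    R x with x ≟ v
    ... | yes _ = d
    ... | no _  = P x
    conforms : ∀ x y → x ≢ y → arc D x y ≡ M (R x) (R y)
    conforms x y x≢y with x ≟ v | y ≟ v
    ... | yes refl | yes refl = ⊥-elim (x≢y refl)
    ... | yes refl | no y≢v   = proj₁ (fits y y≢v)
    ... | no x≢v   | yes refl = proj₂ (fits x x≢v)
    ... | no x≢v   | no y≢v   = respects x y x≢v y≢v x≢y

  cannot-join : ∀ {v P c} → ¬ HasMPartition M D → Respects v P → c ≢ v → Agree v c →
                arc D v c ≡ diagonal (P c) → arc D c v ≡ diagonal (P c) → ⊥
  cannot-join {v} {P} {c} ¬partition respects c≢v agree vc cv =
    ¬partition (extends respects (P c) fits)
    where
    fits : ∀ y → y ≢ v → arc D v y ≡ M (P c) (P y) × arc D y v ≡ M (P y) (P c)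
    fits y y≢v with y ≟ c
    ... | yes refl = vc , cv
    ... | no y≢c = trans (proj₁ (agree y y≢v y≢c)) (respects c y c≢v y≢v (y≢c ∘ sym)) ,
                   trans (proj₂ (agree y y≢v y≢c)) (respects y c y≢v c≢v y≢c)

  part-arcs : ∀ {v P x y w} → Respects v P → x ≢ v → y ≢ v → w ≢ v →
              w ≢ x → w ≢ y → P x ≡ P y →
              arc D x w ≡ arc D y w × arc D w x ≡ arc D w y
  part-arcs {P = P} {w = w} respects x≢v y≢v w≢v w≢x w≢y same =
    trans (respects _ _ x≢v w≢v (w≢x ∘ sym))
          (trans (cong (λ i → M i (P w)) same) (sym (respects _ _ y≢v w≢v (w≢y ∘ sym)))) ,
    trans (respects _ _ w≢v x≢v w≢x)
          (trans (cong (M (P w)) same) (sym (respects _ _ w≢v y≢v w≢y)))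

  same-part-agree : ∀ {v P u₀ x y} → Respects v P → Agree v u₀ → u₀ ≢ v →
                    x ≢ v → y ≢ v → P x ≡ P y → P u₀ ≢ P x → Agree x y
  same-part-agree {v} {P} {u₀} {x} {y} respects v~u₀ u₀≢v x≢v y≢v same u₀-apart w w≢x w≢y
    with w ≟ v
  ... | no w≢v = part-arcs respects x≢v y≢v w≢v w≢x w≢y same
  ... | yes refl =
    trans (proj₂ (v~u₀ x x≢v x≢u₀)) (trans (proj₁ via-u₀) (sym (proj₂ (v~u₀ y y≢v y≢u₀)))) ,
    trans (proj₁ (v~u₀ x x≢v x≢u₀)) (trans (proj₂ via-u₀) (sym (proj₁ (v~u₀ y y≢v y≢u₀))))
    where
    x≢u₀ : x ≢ u₀
    x≢u₀ eq = u₀-apart (cong P (sym eq))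
    y≢u₀ : y ≢ u₀
    y≢u₀ eq = u₀-apart (trans (cong P (sym eq)) (sym same))
    via-u₀ : arc D x u₀ ≡ arc D y u₀ × arc D u₀ x ≡ arc D u₀ y
    via-u₀ = part-arcs respects x≢v y≢v u₀≢v (x≢u₀ ∘ sym) (y≢u₀ ∘ sym) same

  same-part-as-twin : ∀ {v P z u u′} → Respects v P → z ≢ v → u ≢ v → u′ ≢ v →
                      z ≢ u → P z ≡ P u → P u′ ≢ P u → Agree u u′ →
                      arc D u u′ ≡ diagonal (P u)
  same-part-as-twin {v} {P} {z} {u} {u′} respects z≢v u≢v u′≢v z≢u same apart agree =
    begin
      arc D u u′          ≡⟨ respects u u′ u≢v u′≢v (apart ∘ sym ∘ cong P) ⟩
      M (P u) (P u′)      ≡⟨ cong (λ i → M i (P u′)) (sym same) ⟩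
      M (P z) (P u′)      ≡⟨ sym (respects z u′ z≢v u′≢v z≢u′) ⟩
      arc D z u′          ≡⟨ sym (proj₂ (agree z z≢u z≢u′)) ⟩
      arc D z u           ≡⟨ respects z u z≢v u≢v z≢u ⟩
      M (P z) (P u)       ≡⟨ cong (λ i → M i (P u)) same ⟩
      diagonal (P u)      ∎
    where
    open ≡-Reasoning
    z≢u′ : z ≢ u′
    z≢u′ eq = apart (trans (cong P (sym eq)) same)

  -- r distinct pairwise agreeing vertices with all arcs between them equal to b:
  -- a homogeneous strong clique (b = true) or independent set (b = false).
  record TwinFamily (b : Bool) (r : ℕ) : Set where
    field
      member    : Fin r → Fin n
      injective : Inj member
      agree     : ∀ a a′ → a ≢ a′ → Agree (member a) (member a′)
      arcs      : ∀ a a′ → a ≢ a′ → arc D (member a) (member a′) ≡ b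

  subset-family : ∀ {b} (S : Subset n) → Homogeneous D S →
                  (∀ x y → x ∈ S → y ∈ S → x ≢ y → arc D x y ≡ b) → TwinFamily b ∣ S ∣
  subset-family S homogeneous b-arcs with enumerate S
  ... | e , e-inj , e∈S = record
    { member    = e
    ; injective = e-inj
    ; agree     = λ a a′ a≢a′ → twins-agree (homogeneous _ _ (e∈S a) (e∈S a′) (a≢a′ ∘ e-inj))
    ; arcs      = λ a a′ a≢a′ → b-arcs _ _ (e∈S a) (e∈S a′) (a≢a′ ∘ e-inj)
    }

  forced-parts : ∀ {b r P} → ¬ HasMPartition M D → (T : TwinFamily b (suc r)) →
                 Respects (TwinFamily.member T zero) P →
                 (∀ a → diagonal (P (TwinFamily.member T (suc a))) ≡ not b) ×
                 Inj (λ a → P (TwinFamily.member T (suc a)))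
  forced-parts {b} {r} {P} ¬partition T respects = off-diagonal , distinct
    where
    open TwinFamily T
    c : Fin r → Fin n
    c a = member (suc a)
    c≢t : ∀ a → c a ≢ member zero
    c≢t a eq = 0≢1+n (sym (injective eq))
    off-diagonal : ∀ a → diagonal (P (c a)) ≡ not b
    off-diagonal a with bool-cases b (diagonal (P (c a)))
    ... | inj₂ off = off
    ... | inj₁ on  = ⊥-elim (cannot-join ¬partition respects (c≢t a) (agree zero (suc a) (λ ()))
                       (trans (arcs zero (suc a) (λ ())) (sym on))
                       (trans (arcs (suc a) zero (λ ())) (sym on)))
    distinct : Inj (P ∘ c)
    distinct {a} {a′} same with a ≟ a′
    ... | yes a≡a′ = a≡a′
    ... | no a≢a′  = ⊥-elim (not-¬ refl (begin
        b                    ≡⟨ sym (arcs (suc a) (suc a′) (a≢a′ ∘ suc-injective)) ⟩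
        arc D (c a) (c a′)   ≡⟨ respects _ _ (c≢t a) (c≢t a′) (a≢a′ ∘ suc-injective ∘ injective) ⟩
        M (P (c a)) (P (c a′)) ≡⟨ cong (λ i → M i (P (c a′))) same ⟩
        diagonal (P (c a′))  ≡⟨ off-diagonal a′ ⟩
        not b                ∎))
      where open ≡-Reasoning

  family-bound : ∀ {b r} → MinimalObstruction M D → TwinFamily b (suc r) →
                 r ≤ countFin diagonal (not b)
  family-bound {r = zero}  _ _ = z≤n
  family-bound {b} {suc r} (¬partition , minimal) T =
    bounded (count-atMost diagonal (not b)) (λ a → P (member (suc a))) (proj₂ forced) (proj₁ forced)
    where
    open TwinFamily T
    partition : Σ (Fin n → Fin m) (Respects (member zero))
    partition = partition-without minimal (member zero) {member (suc zero)} (0≢1+n ∘ sym ∘ injective)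
    P : Fin n → Fin m
    P = proj₁ partition
    forced : (∀ a → diagonal (P (member (suc a))) ≡ not b) × Inj (λ a → P (member (suc a)))
    forced = forced-parts ¬partition T (proj₂ partition)

  module Bound {b : Bool} (K′ : ℕ) (off-count : countFin diagonal (not b) ≡ suc (suc K′))
               (obstruction : MinimalObstruction M D)
               (S : TwinFamily b (suc (suc (suc K′)))) where

    K : ℕ
    K = suc (suc K′)

    open TwinFamily S

    v : Fin n
    v = member zero

    u : Fin K → Fin n
    u a = member (suc a)

    u≢v : ∀ a → u a ≢ v
    u≢v a eq = 0≢1+n (sym (injective eq))

    partition : Σ (Fin n → Fin m) (Respects v)
    partition = partition-without (proj₂ obstruction) v (u≢v zero)

    P : Fin n → Fin m
    P = proj₁ partition

    Occupant : Fin m → Fin n → Set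
    Occupant i x = x ≢ v × P x ≡ i

    u-parts : (∀ a → diagonal (P (u a)) ≡ not b) × Inj (P ∘ u)
    u-parts = forced-parts (proj₁ obstruction) S (proj₂ partition)

    covered : ∀ {i} → diagonal i ≡ not b → ∃ λ a → P (u a) ≡ i
    covered = saturated-covers _≟_ off-parts (P ∘ u) (proj₂ u-parts) (proj₁ u-parts)
      where
      off-parts : AtMost (λ i → diagonal i ≡ not b) K
      off-parts = subst (AtMost (λ i → diagonal i ≡ not b)) off-count (count-atMost diagonal (not b))

    -- No vertex other than u a lies in the ¬b-part of u a: it would force the
    -- arc from u a to another member u a′ (here K ≥ 2 is used) to be ¬b.
    alone : ∀ a {i z} → P (u a) ≡ i → Occupant i z → z ≢ u a → ⊥
    alone a {z = z} uᵢ (z≢v , zᵢ) z≢u = not-¬ refl (begin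
      b                        ≡⟨ sym (arcs (suc a) (suc a′) a≢a′) ⟩
      arc D (u a) (u a′)       ≡⟨ same-part-as-twin (proj₂ partition) z≢v (u≢v a) (u≢v a′) z≢u same
                                    (a′≢a ∘ proj₂ u-parts) (agree (suc a) (suc a′) a≢a′) ⟩
      diagonal (P (u a))       ≡⟨ proj₁ u-parts a ⟩
      not b                    ∎)
      where
      open ≡-Reasoning
      same : P z ≡ P (u a)
      same = trans zᵢ (sym uᵢ)
      a′ : Fin K
      a′ = proj₁ (another a)
      a′≢a : a′ ≢ a
      a′≢a = proj₂ (another a)
      a≢a′ : suc a ≢ suc a′
      a≢a′ = a′≢a ∘ sym ∘ suc-injective

    singleton-parts : ∀ i → diagonal i ≡ not b → AtMost (Occupant i) 1
    bounded (singleton-parts i off) {zero}        _ _     _      = z≤n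
    bounded (singleton-parts i off) {suc zero}    _ _     _      = ≤-refl
    bounded (singleton-parts i off) {suc (suc s)} h h-inj inPart with covered off
    ... | a , uᵢ with h zero ≟ u a
    ...   | no  x≢u = ⊥-elim (alone a uᵢ (inPart zero) x≢u)
    ...   | yes x≡u = ⊥-elim (alone a uᵢ (inPart (suc zero)) (λ y≡u → 0≢1+n (h-inj (trans x≡u (sym y≡u)))))

    -- The vertices of a b-part form a twin family, so there are at most K + 1.
    bounded-parts : ∀ j → diagonal j ≡ b → AtMost (Occupant j) (suc K)
    bounded (bounded-parts j on) {zero}  _ _     _      = z≤n
    bounded (bounded-parts j on) {suc s} w w-inj inPart =
      s≤s (subst (s ≤_) off-count (family-bound obstruction W))
      where
      apart : ∀ a → P (u zero) ≢ P (w a)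
      apart a eq = not-¬ on
        (trans (cong diagonal (sym (trans eq (proj₂ (inPart a))))) (proj₁ u-parts zero))
      W : TwinFamily b (suc s)
      W = record
        { member    = w
        ; injective = w-inj
        ; agree     = λ a a′ _ → same-part-agree (proj₂ partition) (agree zero (suc zero) (λ ()))
                        (u≢v zero) (proj₁ (inPart a)) (proj₁ (inPart a′))
                        (trans (proj₂ (inPart a)) (sym (proj₂ (inPart a′)))) (apart a)
        ; arcs      = λ a a′ a≢a′ →
                        trans (proj₂ partition _ _ (proj₁ (inPart a)) (proj₁ (inPart a′)) (a≢a′ ∘ w-inj))
                              (trans (cong₂ M (proj₂ (inPart a)) (proj₂ (inPart a′))) on)
        }

    capacity : Fin m → ℕ
    capacity i = select (suc K) 1 b (diagonal i)

    capacity-bound : ∀ i → AtMost (Occupant i) (capacity i)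
    capacity-bound i with bool-cases b (diagonal i)
    ... | inj₁ on  = subst (AtMost (Occupant i)) (sym (select-match on)) (bounded-parts i on)
    ... | inj₂ off = subst (AtMost (Occupant i)) (sym (select-mismatch off)) (singleton-parts i off)

    order-bound : n ≤ suc K * suc (countFin diagonal b)
    order-bound = subst (n ≤_) total (count-avoiding v P capacity capacity-bound)
      where
      open ≡-Reasoning
      L = countFin diagonal b
      arithmetic : ∀ K L → suc (suc K * L + 1 * K) ≡ suc K * suc L
      arithmetic = solve-∀
      total : suc (sum capacity) ≡ suc K * suc L
      total = begin
        suc (sum capacity)                               ≡⟨ cong suc (sum-select diagonal (suc K) 1 b) ⟩
        suc (suc K * L + 1 * countFin diagonal (not b))  ≡⟨ cong (λ k → suc (suc K * L + 1 * k)) off-count ⟩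
        suc (suc K * L + 1 * K)                          ≡⟨ arithmetic K L ⟩
        suc K * suc L                                    ∎

homogeneous-bound : ∀ {m n} (M : Matrix m) (D : Digraph n) (b : Bool) (k : ℕ) →
                    countFin (λ i → M i i) (not b) ≡ k → MinimalObstruction M D → 2 ≤ k →
                    (S : Subset n) → Homogeneous D S →
                    (∀ x y → x ∈ S → y ∈ S → x ≢ y → arc D x y ≡ b) →
                    ∣ S ∣ ≡ suc k → n ≤ suc k * suc (countFin (λ i → M i i) b)
homogeneous-bound M D b (suc (suc K′)) off-count obstruction (s≤s (s≤s z≤n))
                  S homogeneous b-arcs size =
  Bound.order-bound K′ off-count obstruction
    (subst (TwinFamily b) size (subset-family S homogeneous b-arcs))
  where open Obstruction M D

lemma7 : ∀ {m n} (M : Matrix m) (k ℓ : ℕ) →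
         zerosOnDiag M ≡ k → onesOnDiag M ≡ ℓ →
         (D : Digraph n) → MinimalObstruction M D →
         (2 ≤ k → (S : Subset n) → Homogeneous D S → StrongClique D S →
            ∣ S ∣ ≡ suc k → n ≤ suc k * suc ℓ)
         ×
         (2 ≤ ℓ → (S : Subset n) → Homogeneous D S → Independent D S →
            ∣ S ∣ ≡ suc ℓ → n ≤ suc k * suc ℓ)
lemma7 {n = n} M k ℓ zeros ones D obstruction =
  (λ 2≤k S homogeneous clique size →
     subst (λ l → n ≤ suc k * suc l) ones
       (homogeneous-bound M D true k zeros obstruction 2≤k S homogeneous clique size)) ,
  (λ 2≤ℓ S homogeneous independent size →
     subst (n ≤_) (trans (cong (λ l → suc ℓ * suc l) zeros) (*-comm (suc ℓ) (suc k)))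
       (homogeneous-bound M D false ℓ ones obstruction 2≤ℓ S homogeneous independent size))
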